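{- Let $\mathcal{G}$ satisfy the standing assumptions below. The map $F$ defined below is injective.
   Context: Production grammars. A production grammar is $\mathcal{G}=(V,V_i,V_t,P)$ with $V$ a finite alphabet, $V_i,V_t\subseteq V$ and $P$ a finite set of pairs $(\Gamma,\Delta)$ of strings over $V$, written $\Gamma\to\Delta$. Elements of $V_t$ are terminals, others nonterminals. A production is applicable to $\sigma$ if $\sigma=\sigma_1\Gamma\sigma_2$; it is leftmost applicable there if for every production $\Gamma'\to\Delta'$ and every decomposition $\sigma=\gamma_1\Gamma'\gamma_2$, $|\Gamma|\le|\Gamma'|$ and $|\sigma_1|\le|\gamma_1|$. Standing assumptions: $\mathcal{G}$ is well-formed (every reduction sequence ultimately leads to a sentence); no production has an empty side; no terminal occurs on a left side; $\mathcal{G}$ is normal (both sides of every production have length 1 or 2); $V_i=\{S\}$; every production whose right side contains a terminal has as right side a single terminal. Machine states. A state of the production machine consists of the contents of three tapes (top, middle, bottom), infinite in both directions, divided into squares each empty or holding one symbol of $V$, with one scanned square per tape (aligned). The map $F$. Let $\sigma$ be a string of the form $t_1\cdots t_p\,n_1\cdots n_q\,P_1P_2\,m_1\cdots m_r$ where $t_1,\dots,t_p$ are terminals, $n_i,P_1,P_2,m_j$ are nonterminals, and the leftmost applicable production to $\sigma$ has left side $P_1P_2$ ($P_1$ possibly empty). Then $F(\sigma)$ is the state in which: the top scanned square is empty and $m_1,\dots,m_r$ occupy (in order) the squares immediately to its right; the middle scanned square holds $P_2$ and $t_1,\dots,t_p$ occupy (in order) the squares immediately to its left; the bottom scanned square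 holds $P_1$ (empty if $P_1$ is empty) and $n_1,\dots,n_q$ occupy (in order, $n_q$ adjacent) the squares immediately to its left; all other squares are empty. If no production is applicable to $\sigma$, $F(\sigma)$ is the state in which $\sigma$ occupies the squares of the middle tape immediately to the left of its scanned square and all other squares are empty. -}

module Defs where

open import Data.Nat using (ℕ; zero; suc; _≤_)
open import Data.Fin using (Fin)
open import Data.Bool using (Bool; true; false)
open import Data.Integer using (ℤ; +_; -[1+_])
open import Data.List using (List; []; _∷_; _++_; length; reverse; [_]; fromMaybe)
open import Data.List.Relation.Unary.All using (All)
open import Data.List.Relation.Unary.Any using (Any)
open import Data.List.Membership.Propositional using (_∈_)
open import Data.Maybe using (Maybe; just; nothing)
import Data.Maybe.Relation.Unary.All as MaybeAll
open import Data.Product using (Σ; ∃; _×_; _,_)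
import Data.Sum
open import Relation.Binary.PropositionalEquality using (_≡_; _≢_)
open import Relation.Nullary using (¬_)
open import Relation.Binary.Construct.Closure.ReflexiveTransitive using (Star)

record Grammar : Set where
  field
    size        : ℕ
    terminal    : Fin size → Bool
    initial     : Fin size → Bool
    productions : List (List (Fin size) × List (Fin size))

nth : {A : Set} → List A → ℕ → Maybe A
nth []       _       = nothing
nth (x ∷ xs) zero    = just x
nth (x ∷ xs) (suc k) = nth xs k

module _ (G : Grammar) where
  open Grammar G

  V : Set
  V = Fin size

  Str : Set
  Str = List V

  IsTerminal : V → Set
  IsTerminal x = terminal x ≡ true

  IsNonterminal : V → Set
  IsNonterminal x = terminal x ≡ false

  Sentence : Str → Set
  Sentence σ = All IsTerminal σ

  _⇒_ : Str → Str → Set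
  σ ⇒ τ = Σ Str λ Γ → Σ Str λ Δ → Σ Str λ σ₁ → Σ Str λ σ₂ →
          ((Γ , Δ) ∈ productions) × (σ ≡ σ₁ ++ Γ ++ σ₂) × (τ ≡ σ₁ ++ Δ ++ σ₂)

  NoneApplicable : Str → Set
  NoneApplicable σ = ∀ Γ Δ σ₁ σ₂ → (Γ , Δ) ∈ productions → σ ≢ σ₁ ++ Γ ++ σ₂

  LeftmostApplicable : Str → Str → Str → Set
  LeftmostApplicable σ σ₁ Γ =
    (Σ Str λ Δ → Σ Str λ σ₂ → ((Γ , Δ) ∈ productions) × (σ ≡ σ₁ ++ Γ ++ σ₂)) ×
    (∀ Γ' Δ' γ₁ γ₂ → (Γ' , Δ') ∈ productions → σ ≡ γ₁ ++ Γ' ++ γ₂ →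
       (length Γ ≤ length Γ') × (length σ₁ ≤ length γ₁))

  WellFormed : Set
  WellFormed =
    (∀ s → initial s ≡ true →
       ¬ (Σ (ℕ → Str) λ f → (f zero ≡ [ s ]) × (∀ i → f i ⇒ f (suc i)))) ×
    (∀ s σ → initial s ≡ true → Star _⇒_ [ s ] σ → (∀ τ → ¬ (σ ⇒ τ)) → Sentence σ)

  record StandingAssumptions : Set where
    field
      wellFormed   : WellFormed
      lhsNonEmpty  : ∀ Γ Δ → (Γ , Δ) ∈ productions → Γ ≢ []
      rhsNonEmpty  : ∀ Γ Δ → (Γ , Δ) ∈ productions → Δ ≢ []
      lhsNoTerminal : ∀ Γ Δ → (Γ , Δ) ∈ productions → All IsNonterminal Γ
      normalL      : ∀ Γ Δ → (Γ , Δ) ∈ productions → (length Γ ≡ 1) Data.Sum.⊎ (length Γ ≡ 2)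
      normalR      : ∀ Γ Δ → (Γ , Δ) ∈ productions → (length Δ ≡ 1) Data.Sum.⊎ (length Δ ≡ 2)
      initialS     : Σ V λ S → ∀ x → (initial x ≡ true → x ≡ S) × (x ≡ S → initial x ≡ true)
      terminalRhs  : ∀ Γ Δ → (Γ , Δ) ∈ productions → Any IsTerminal Δ →
                       Σ V λ t → Δ ≡ [ t ]

  -- machine states: three two-way infinite tapes; the (aligned) scanned
  -- squares are at position 0; nothing = empty square
  record State : Set where
    field
      top : ℤ → Maybe V
      mid : ℤ → Maybe V
      bot : ℤ → Maybe V

  _≈S_ : State → State → Set
  s ≈S s' = ∀ z → (State.top s z ≡ State.top s' z) × (State.mid s z ≡ State.mid s' z)
                  × (State.bot s z ≡ State.bot s' z)

  rightOf : Str → ℤ → Maybe V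
  rightOf xs (+ zero)  = nothing
  rightOf xs (+ suc k) = nth xs k
  rightOf xs -[1+ k ]  = nothing

  -- tape: scanned square holds c, xs in the squares immediately to its left
  -- (last element of xs adjacent to the scanned square)
  leftOf : Maybe V → Str → ℤ → Maybe V
  leftOf c xs (+ zero)  = c
  leftOf c xs (+ suc k) = nothing
  leftOf c xs -[1+ k ]  = nth (reverse xs) k

  -- FState σ s : s is F(σ) (F is defined exactly on the strings described)
  data FState (σ : Str) : State → Set where
    applicable : (ts ns ms : Str) (P₁ : Maybe V) (P₂ : V) →
      All IsTerminal ts → All IsNonterminal ns → All IsNonterminal ms →
      MaybeAll.All IsNonterminal P₁ → IsNonterminal P₂ →
      σ ≡ ts ++ ns ++ fromMaybe P₁ ++ P₂ ∷ ms →
      LeftmostApplicable σ (ts ++ ns) (fromMaybe P₁ ++ [ P₂ ]) →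
      FState σ (record { top = rightOf ms ; mid = leftOf (just P₂) ts ; bot = leftOf P₁ ns })
    noneApplicable : NoneApplicable σ →
      FState σ (record { top = λ _ → nothing ; mid = leftOf nothing σ ; bot = λ _ → nothing })

{-# OPTIONS --safe #-}
-- F(σ) writes each piece t, n, P₁, P₂, m of the decomposition of σ (or σ itself,
-- when nothing is applicable) on its own ordered region of the tapes, and whether
-- the middle scanned square is filled tells the two cases apart. So σ can be read
-- back from F(σ).
module Submission where

open import Defs
open import Function using (_∘_)
open import Relation.Binary.PropositionalEquality using (_≡_; _≗_; refl; cong₂; sym; trans)
open import Data.Nat using (zero; suc)
open import Data.Integer using (+_; -[1+_])
open import Data.List using (List; []; _∷_)
open import Data.List.Properties using (reverse-injective)
open import Data.Maybe using (Maybe)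
open import Data.Maybe.Properties using (just-injective)
open import Data.Product using (_×_; _,_; proj₁; proj₂)

nth-injective : {A : Set} {xs ys : List A} → nth xs ≗ nth ys → xs ≡ ys
nth-injective {xs = []}     {[]}     _ = refl
nth-injective {xs = []}     {_ ∷ _}  h with h zero
... | ()
nth-injective {xs = _ ∷ _}  {[]}     h with h zero
... | ()
nth-injective {xs = _ ∷ _}  {_ ∷ _}  h =
  cong₂ _∷_ (just-injective (h zero)) (nth-injective (h ∘ suc))

module _ {G : Grammar} where

  rightOf-injective : {xs ys : Str G} → rightOf G xs ≗ rightOf G ys → xs ≡ ys
  rightOf-injective h = nth-injective (h ∘ +_ ∘ suc)

  leftOf-injective : {c c' : Maybe (V G)} {xs ys : Str G} →
                     leftOf G c xs ≗ leftOf G c' ys → c ≡ c' × xs ≡ ys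
  leftOf-injective h = h (+ 0) , reverse-injective (nth-injective (h ∘ -[1+_]))

  module _ (s s' : State G) (s≈s' : _≈S_ G s s') where

    top-≗ : State.top s ≗ State.top s'
    top-≗ = proj₁ ∘ s≈s'

    mid-≗ : State.mid s ≗ State.mid s'
    mid-≗ = proj₁ ∘ proj₂ ∘ s≈s'

    bot-≗ : State.bot s ≗ State.bot s'
    bot-≗ = proj₂ ∘ proj₂ ∘ s≈s'

mainTheorem5 : (G : Grammar) → StandingAssumptions G →
    ∀ (σ τ : Str G) (s s' : State G) →
    FState G σ s → FState G τ s' → _≈S_ G s s' → σ ≡ τ
mainTheorem5 G _ σ τ s s'
  (applicable _ _ _ _ _ _ _ _ _ _ σ≡ _) (applicable _ _ _ _ _ _ _ _ _ _ τ≡ _) s≈s'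
  with leftOf-injective (mid-≗ s s' s≈s') | leftOf-injective (bot-≗ s s' s≈s')
     | rightOf-injective (top-≗ s s' s≈s')
... | refl , refl | refl , refl | refl = trans σ≡ (sym τ≡)
mainTheorem5 G _ σ τ s s' (applicable _ _ _ _ _ _ _ _ _ _ _ _) (noneApplicable _) s≈s'
  with mid-≗ s s' s≈s' (+ 0)
... | ()
mainTheorem5 G _ σ τ s s' (noneApplicable _) (applicable _ _ _ _ _ _ _ _ _ _ _ _) s≈s'
  with mid-≗ s s' s≈s' (+ 0)
... | ()
mainTheorem5 G _ σ τ s s' (noneApplicable _) (noneApplicable _) s≈s' =
  proj₂ (leftOf-injective (mid-≗ s s' s≈s'))
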